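{- In every $\delta$-algebra, for every $n\in\mathbb{N}$ and all elements $x,y,x_1,\ldots,x_n$, writing $\vec 0=(0,0,\ldots)$: (1) $\delta(x_1,\ldots,x_n,\vec 0)=\bigoplus_{i=1}^n f_{1/2^i}(x_i)$; (2) $\delta(x,y,y,\ldots)=f_{1/2}(x)\oplus f_{1/2}(y)$; (3) $f_{1/2}(x)\oplus f_{1/2}(x)=x$.
   Context: An MV-algebra is a structure $(A,\oplus,\neg,0)$ such that $(A,\oplus,0)$ is a commutative monoid, $\neg\neg x=x$, $x\oplus\neg 0=\neg 0$, and $\neg(\neg x\oplus y)\oplus y=\neg(\neg y\oplus x)\oplus x$. Write $1:=\neg 0$, $x\odot y:=\neg(\neg x\oplus\neg y)$, $x\ominus y:=x\odot\neg y$, $d(x,y):=(x\ominus y)\oplus(y\ominus x)$; $x\le y$ iff $x\ominus y=0$ defines a lattice order with $x\vee y=\neg(\neg x\oplus y)\oplus y$. A $\delta$-algebra is a structure $(A,\delta,\oplus,\neg,0)$ where $(A,\oplus,\neg,0)$ is an MV-algebra and $\delta$ is an operation of countably infinite arity such that, writing $\vec x=(x_1,x_2,\ldots)$ and $f_{1/2}(x):=\delta(x,\vec 0)$: (A1) $d(\delta(\vec x),\delta(x_1,\vec 0))=\delta(0,x_2,x_3,\ldots)$; (A2) $f_{1/2}(\delta(\vec x))=\delta(f_{1/2}(x_1),f_{1/2}(x_2),\ldots)$; (A3) $\delta(x,x,\ldots)=x$; (A4) $\delta(0,\vec x)=f_{1/2}(\delta(\vec x))$; (A5) $\delta(x_1\oplus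 y_1,x_2\oplus y_2,\ldots)\ge\delta(x_1,x_2,\ldots)$; (A6) $f_{1/2}(x\ominus y)=f_{1/2}(x)\ominus f_{1/2}(y)$. $f_{1/2^i}$ is the $i$-fold iterate of $f_{1/2}$. -}

module Defs where

open import Data.Nat using (ℕ; zero; suc)
open import Data.Fin using (Fin; toℕ)
open import Data.Fin as F using ()
open import Function using (_∘_)
open import Relation.Binary.PropositionalEquality using (_≡_)
open import Level using (Level)

-- Infinite sequences x = (x₁, x₂, …) are functions ℕ → A, with
-- x 0 = x₁, x 1 = x₂, and so on.

infixr 5 _∷ₛ_
_∷ₛ_ : ∀ {a} {A : Set a} → A → (ℕ → A) → (ℕ → A)
(a ∷ₛ x) zero    = a
(a ∷ₛ x) (suc n) = x n

constₛ : ∀ {a} {A : Set a} → A → (ℕ → A)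
constₛ c _ = c

_++ₛ_ : ∀ {a} {A : Set a} {n : ℕ} → (Fin n → A) → (ℕ → A) → (ℕ → A)
_++ₛ_ {n = zero}  xs t = t
_++ₛ_ {n = suc n} xs t = xs F.zero ∷ₛ ((xs ∘ F.suc) ++ₛ t)

iterate : ∀ {a} {A : Set a} → ℕ → (A → A) → A → A
iterate zero    f a = a
iterate (suc i) f a = f (iterate i f a)

record MVAlgebra (a : Level) : Set (Level.suc a) where
  infixl 6 _⊕_
  field
    Carrier : Set a
    _⊕_     : Carrier → Carrier → Carrier
    ¬_      : Carrier → Carrier
    𝟘       : Carrier
    ⊕-assoc    : ∀ x y z → (x ⊕ y) ⊕ z ≡ x ⊕ (y ⊕ z)
    ⊕-comm     : ∀ x y → x ⊕ y ≡ y ⊕ x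
    ⊕-identityʳ : ∀ x → x ⊕ 𝟘 ≡ x
    ¬¬-involutive : ∀ x → ¬ (¬ x) ≡ x
    ⊕-absorbing : ∀ x → x ⊕ ¬ 𝟘 ≡ ¬ 𝟘
    łukasiewicz : ∀ x y → ¬ (¬ x ⊕ y) ⊕ y ≡ ¬ (¬ y ⊕ x) ⊕ x

  𝟙 : Carrier
  𝟙 = ¬ 𝟘

  infixl 7 _⊙_ _⊖_
  _⊙_ : Carrier → Carrier → Carrier
  x ⊙ y = ¬ (¬ x ⊕ ¬ y)

  _⊖_ : Carrier → Carrier → Carrier
  x ⊖ y = x ⊙ ¬ y

  dist : Carrier → Carrier → Carrier
  dist x y = (x ⊖ y) ⊕ (y ⊖ x)

  infix 4 _≤_
  _≤_ : Carrier → Carrier → Set a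
  x ≤ y = x ⊖ y ≡ 𝟘

  ⨁ : ∀ {n} → (Fin n → Carrier) → Carrier
  ⨁ {zero}  xs = 𝟘
  ⨁ {suc n} xs = xs F.zero ⊕ ⨁ (xs ∘ F.suc)

record DeltaAlgebra (a : Level) : Set (Level.suc a) where
  field
    mv : MVAlgebra a
  open MVAlgebra mv public
  field
    δ : (ℕ → Carrier) → Carrier
    -- δ is a function on sequences: pointwise-equal arguments give equal
    -- values (automatic in set-theoretic semantics; needed since Agda lacks funext)
    δ-cong : ∀ {x y : ℕ → Carrier} → (∀ i → x i ≡ y i) → δ x ≡ δ y

  f½ : Carrier → Carrier
  f½ x = δ (x ∷ₛ constₛ 𝟘)

  f½^ : ℕ → Carrier → Carrier
  f½^ i = iterate i f½

  field
    A1 : ∀ (x : ℕ → Carrier) →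
         dist (δ x) (δ (x 0 ∷ₛ constₛ 𝟘)) ≡ δ (𝟘 ∷ₛ (λ i → x (suc i)))
    A2 : ∀ (x : ℕ → Carrier) → f½ (δ x) ≡ δ (λ i → f½ (x i))
    A3 : ∀ x → δ (constₛ x) ≡ x
    A4 : ∀ (x : ℕ → Carrier) → δ (𝟘 ∷ₛ x) ≡ f½ (δ x)
    A5 : ∀ (x y : ℕ → Carrier) → δ x ≤ δ (λ i → x i ⊕ y i)
    A6 : ∀ x y → f½ (x ⊖ y) ≡ f½ x ⊖ f½ y

-- Axioms A5 and A1 split δ (x ∷ t) as f½ x ⊕ δ (𝟘 ∷ t): the first summand lies
-- below δ (x ∷ t) by monotonicity, and the distance between them is δ (𝟘 ∷ t),
-- which A4 rewrites as f½ (δ t). Iterating this along a finite prefix, with A2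
-- pushing f½ inside δ, gives (1); taking t constant and using A3 gives (2), and
-- (3) is (2) with y = x.
module Submission where

open import Defs
open import Level using (Level)
open import Data.Nat using (ℕ; suc; zero)
open import Data.Fin using (Fin; toℕ)
open import Data.Fin as F using ()
open import Data.Product using (_×_; _,_)
open import Function using (_∘_)
open import Relation.Binary.PropositionalEquality
  using (_≡_; refl; sym; trans; cong; cong₂; module ≡-Reasoning)

module _ {a} {A : Set a} where

  ∷ₛ-constₛ : ∀ (c : A) i → (c ∷ₛ constₛ c) i ≡ constₛ c i
  ∷ₛ-constₛ c zero    = refl
  ∷ₛ-constₛ c (suc i) = refl

  map-++ₛ-constₛ : ∀ {b} {B : Set b} (g : A → B) {n} (xs : Fin n → A) (c : A) i →
                   g ((xs ++ₛ constₛ c) i) ≡ ((g ∘ xs) ++ₛ constₛ (g c)) i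
  map-++ₛ-constₛ g {zero}  xs c i       = refl
  map-++ₛ-constₛ g {suc n} xs c zero    = refl
  map-++ₛ-constₛ g {suc n} xs c (suc i) = map-++ₛ-constₛ g (xs ∘ F.suc) c i

  iterate-suc′ : ∀ k (f : A → A) z → iterate k f (f z) ≡ f (iterate k f z)
  iterate-suc′ zero    f z = refl
  iterate-suc′ (suc k) f z = cong f (iterate-suc′ k f z)

module MVAlgebraProperties {a} (M : MVAlgebra a) where
  open MVAlgebra M
  open ≡-Reasoning

  ⊕-identityˡ : ∀ x → 𝟘 ⊕ x ≡ x
  ⊕-identityˡ x = trans (⊕-comm 𝟘 x) (⊕-identityʳ x)

  ≤⇒⊕-⊖-cancel : ∀ {x y} → x ≤ y → x ⊕ (y ⊖ x) ≡ y
  ≤⇒⊕-⊖-cancel {x} {y} x≤y = begin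
    x ⊕ ¬ (¬ y ⊕ ¬ (¬ x))  ≡⟨ cong (λ z → x ⊕ ¬ (¬ y ⊕ z)) (¬¬-involutive x) ⟩
    x ⊕ ¬ (¬ y ⊕ x)        ≡⟨ ⊕-comm x _ ⟩
    ¬ (¬ y ⊕ x) ⊕ x        ≡⟨ łukasiewicz y x ⟩
    ¬ (¬ x ⊕ y) ⊕ y        ≡⟨ cong (λ z → ¬ (¬ x ⊕ z) ⊕ y) (sym (¬¬-involutive y)) ⟩
    (x ⊖ y) ⊕ y            ≡⟨ cong (_⊕ y) x≤y ⟩
    𝟘 ⊕ y                  ≡⟨ ⊕-identityˡ y ⟩
    y                      ∎

  ≤⇒dist≡⊖ : ∀ {x y} → x ≤ y → dist y x ≡ y ⊖ x
  ≤⇒dist≡⊖ {x} {y} x≤y = trans (cong ((y ⊖ x) ⊕_) x≤y) (⊕-identityʳ (y ⊖ x))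

  ⨁-cong : ∀ {n} {xs ys : Fin n → Carrier} → (∀ i → xs i ≡ ys i) → ⨁ xs ≡ ⨁ ys
  ⨁-cong {zero}  eq = refl
  ⨁-cong {suc n} eq = cong₂ _⊕_ (eq F.zero) (⨁-cong (eq ∘ F.suc))

module DeltaAlgebraProperties {a} (D : DeltaAlgebra a) where
  open DeltaAlgebra D
  open MVAlgebraProperties mv
  open ≡-Reasoning

  f½-𝟘 : f½ 𝟘 ≡ 𝟘
  f½-𝟘 = trans (δ-cong (∷ₛ-constₛ 𝟘)) (A3 𝟘)

  δ-∷ₛ : ∀ x (t : ℕ → Carrier) → δ (x ∷ₛ t) ≡ f½ x ⊕ f½ (δ t)
  δ-∷ₛ x t = begin
    δ (x ∷ₛ t)                   ≡⟨ sym (≤⇒⊕-⊖-cancel f½x≤δ) ⟩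
    f½ x ⊕ (δ (x ∷ₛ t) ⊖ f½ x)   ≡⟨ cong (f½ x ⊕_) (trans (sym (≤⇒dist≡⊖ f½x≤δ)) (A1 (x ∷ₛ t))) ⟩
    f½ x ⊕ δ (𝟘 ∷ₛ t)            ≡⟨ cong (f½ x ⊕_) (A4 t) ⟩
    f½ x ⊕ f½ (δ t)              ∎
    where
    split : ∀ i → (x ∷ₛ constₛ 𝟘) i ⊕ (𝟘 ∷ₛ t) i ≡ (x ∷ₛ t) i
    split zero    = ⊕-identityʳ x
    split (suc i) = ⊕-identityˡ (t i)

    f½x≤δ : f½ x ≤ δ (x ∷ₛ t)
    f½x≤δ = trans (cong (f½ x ⊖_) (sym (δ-cong split))) (A5 (x ∷ₛ constₛ 𝟘) (𝟘 ∷ₛ t))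

  f½-δ-++ₛ-zeros : ∀ {n} (xs : Fin n → Carrier) →
                   f½ (δ (xs ++ₛ constₛ 𝟘)) ≡ δ ((f½ ∘ xs) ++ₛ constₛ 𝟘)
  f½-δ-++ₛ-zeros xs = begin
    f½ (δ (xs ++ₛ constₛ 𝟘))            ≡⟨ A2 _ ⟩
    δ (f½ ∘ (xs ++ₛ constₛ 𝟘))          ≡⟨ δ-cong (map-++ₛ-constₛ f½ xs 𝟘) ⟩
    δ ((f½ ∘ xs) ++ₛ constₛ (f½ 𝟘))     ≡⟨ cong (λ c → δ ((f½ ∘ xs) ++ₛ constₛ c)) f½-𝟘 ⟩
    δ ((f½ ∘ xs) ++ₛ constₛ 𝟘)          ∎

  δ-++ₛ-zeros : ∀ n (xs : Fin n → Carrier) →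
                δ (xs ++ₛ constₛ 𝟘) ≡ ⨁ (λ i → f½^ (suc (toℕ i)) (xs i))
  δ-++ₛ-zeros zero    xs = A3 𝟘
  δ-++ₛ-zeros (suc n) xs = begin
    δ (xs F.zero ∷ₛ (rest ++ₛ constₛ 𝟘))                    ≡⟨ δ-∷ₛ _ _ ⟩
    f½ (xs F.zero) ⊕ f½ (δ (rest ++ₛ constₛ 𝟘))             ≡⟨ cong (f½ (xs F.zero) ⊕_) (f½-δ-++ₛ-zeros rest) ⟩
    f½ (xs F.zero) ⊕ δ ((f½ ∘ rest) ++ₛ constₛ 𝟘)           ≡⟨ cong (f½ (xs F.zero) ⊕_) (δ-++ₛ-zeros n (f½ ∘ rest)) ⟩
    f½ (xs F.zero) ⊕ ⨁ (λ i → f½^ (suc (toℕ i)) (f½ (rest i)))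
      ≡⟨ cong (f½ (xs F.zero) ⊕_) (⨁-cong (λ i → cong f½ (iterate-suc′ (toℕ i) f½ (rest i)))) ⟩
    f½ (xs F.zero) ⊕ ⨁ (λ i → f½^ (suc (suc (toℕ i))) (rest i)) ∎
    where rest = xs ∘ F.suc

  δ-∷ₛ-constₛ : ∀ x y → δ (x ∷ₛ constₛ y) ≡ f½ x ⊕ f½ y
  δ-∷ₛ-constₛ x y = trans (δ-∷ₛ x (constₛ y)) (cong (λ z → f½ x ⊕ f½ z) (A3 y))

  f½x⊕f½x≡x : ∀ x → f½ x ⊕ f½ x ≡ x
  f½x⊕f½x≡x x = begin
    f½ x ⊕ f½ x        ≡⟨ sym (δ-∷ₛ-constₛ x x) ⟩
    δ (x ∷ₛ constₛ x)  ≡⟨ δ-cong (∷ₛ-constₛ x) ⟩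
    δ (constₛ x)       ≡⟨ A3 x ⟩
    x                  ∎

corollary4p10 : ∀ {a : Level} (D : DeltaAlgebra a) → let open DeltaAlgebra D in
    ∀ (n : ℕ) (x y : Carrier) (xs : Fin n → Carrier) →
    (δ (xs ++ₛ constₛ 𝟘) ≡ ⨁ (λ i → f½^ (suc (toℕ i)) (xs i)))
    × (δ (x ∷ₛ constₛ y) ≡ f½ x ⊕ f½ y)
    × (f½ x ⊕ f½ x ≡ x)
corollary4p10 D n x y xs = δ-++ₛ-zeros n xs , δ-∷ₛ-constₛ x y , f½x⊕f½x≡x x
  where open DeltaAlgebraProperties D
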